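{- Let $\Gamma$ be a subgroup of finite index in $\mathrm{SL}_3(\mathbb{Z})$. Let $x,y,z$ be nonzero vectors in $\mathbb{Q}^3$, and let $V\subset\mathbb{Q}^3$ be a plane with $x,y\in V$ and $z\notin V$. Let $\gamma\in\Gamma$ satisfy $\gamma V=V$ and $\gamma z=\pm z$. Then $[x,\gamma x,z]_\Gamma=[y,\gamma y,z]_\Gamma$ in $H_0(\Gamma,\mathrm{St}(\mathbb{Q}^3))$.
   Context: $\mathrm{St}(\mathbb{Q}^3)$ is the Steinberg module with $\mathbb{Q}$-coefficients, $\tilde H_1$ of the Tits building of $\mathbb{Q}^3$ (vertices: proper nonzero subspaces, simplices: flags). For a basis $v_1,v_2,v_3$ of $\mathbb{Q}^3$, the modular symbol $[v_1,v_2,v_3]$ is the fundamental class of the hexagon whose vertices are the spans of proper nonempty subsets of $\{v_1,v_2,v_3\}$, oriented so that $g[v_1,v_2,v_3]=[gv_1,gv_2,gv_3]$ for $g\in\mathrm{GL}_3(\mathbb{Q})$; by convention $[w_1,w_2,w_3]=0$ if $w_1,w_2,w_3$ are linearly dependent. $[m]_\Gamma$ denotes the image of $[m]$ in the coinvariants $H_0(\Gamma,\mathrm{St}(\mathbb{Q}^3))$. -}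

module Defs where

open import Data.Integer as ℤ using (ℤ)
open import Data.Rational as ℚ using (ℚ; 0ℚ; 1ℚ)
open import Data.Rational.Properties using () renaming (_≟_ to _≟ℚ_)
open import Data.List using (List; []; _∷_; _++_; map; concatMap; foldr)
open import Data.List.Relation.Unary.All using (All)
import Data.List.Relation.Unary.Any
open import Data.Product using (_×_; _,_; Σ; ∃)
open import Relation.Binary.PropositionalEquality using (_≡_; _≢_)
open import Relation.Nullary using (Dec; yes; no; ¬_)
open import Relation.Nullary.Decidable using (_×-dec_)

record Q3 : Set where
  constructor ⟨_,_,_⟩
  field
    c₁ c₂ c₃ : ℚ
open Q3 public

record Z3 : Set where
  constructor ⟪_,_,_⟫
  field
    e₁ e₂ e₃ : ℤ
open Z3 public

record Mat : Set where
  constructor mat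
  field
    row₁ row₂ row₃ : Z3
open Mat public

0v : Q3
0v = ⟨ 0ℚ , 0ℚ , 0ℚ ⟩

_+v_ : Q3 → Q3 → Q3
⟨ a , b , c ⟩ +v ⟨ a' , b' , c' ⟩ = ⟨ a ℚ.+ a' , b ℚ.+ b' , c ℚ.+ c' ⟩

_·v_ : ℚ → Q3 → Q3
s ·v ⟨ a , b , c ⟩ = ⟨ s ℚ.* a , s ℚ.* b , s ℚ.* c ⟩

-v_ : Q3 → Q3
-v ⟨ a , b , c ⟩ = ⟨ ℚ.- a , ℚ.- b , ℚ.- c ⟩

dot : Q3 → Q3 → ℚ
dot ⟨ a , b , c ⟩ ⟨ a' , b' , c' ⟩ = a ℚ.* a' ℚ.+ b ℚ.* b' ℚ.+ c ℚ.* c'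

cross : Q3 → Q3 → Q3
cross ⟨ a , b , c ⟩ ⟨ a' , b' , c' ⟩ =
  ⟨ b ℚ.* c' ℚ.- c ℚ.* b' , c ℚ.* a' ℚ.- a ℚ.* c' , a ℚ.* b' ℚ.- b ℚ.* a' ⟩

det3 : Q3 → Q3 → Q3 → ℚ
det3 u v w = dot (cross u v) w

_≟v_ : (u v : Q3) → Dec (u ≡ v)
⟨ a , b , c ⟩ ≟v ⟨ a' , b' , c' ⟩ with a ≟ℚ a' | b ≟ℚ b' | c ≟ℚ c'
... | yes _≡_.refl | yes _≡_.refl | yes _≡_.refl = yes _≡_.refl
... | no ne | _ | _ = no λ { _≡_.refl → ne _≡_.refl }
... | yes _ | no ne | _ = no λ { _≡_.refl → ne _≡_.refl }
... | yes _ | yes _ | no ne = no λ { _≡_.refl → ne _≡_.refl }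

_∥?_ : (u v : Q3) → Dec (cross u v ≡ 0v)
u ∥? v = cross u v ≟v 0v

toℚ : ℤ → ℚ
toℚ n = n ℚ./ 1

rowQ : Z3 → Q3
rowQ ⟪ a , b , c ⟫ = ⟨ toℚ a , toℚ b , toℚ c ⟩

_⊙_ : Mat → Q3 → Q3
g ⊙ v = ⟨ dot (rowQ (row₁ g)) v , dot (rowQ (row₂ g)) v , dot (rowQ (row₃ g)) v ⟩

col₁ col₂ col₃ : Mat → Q3
col₁ g = g ⊙ ⟨ 1ℚ , 0ℚ , 0ℚ ⟩
col₂ g = g ⊙ ⟨ 0ℚ , 1ℚ , 0ℚ ⟩
col₃ g = g ⊙ ⟨ 0ℚ , 0ℚ , 1ℚ ⟩

-- action of g on normal vectors of planes: the cofactor matrix of g,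
-- characterised by  cof g (a × b) = (g a) × (g b).
cof⊙ : Mat → Q3 → Q3
cof⊙ g ⟨ n₁ , n₂ , n₃ ⟩ =
  (n₁ ·v cross (col₂ g) (col₃ g)) +v
  ((n₂ ·v cross (col₃ g) (col₁ g)) +v (n₃ ·v cross (col₁ g) (col₂ g)))

dotZ : Z3 → Z3 → ℤ
dotZ ⟪ a , b , c ⟫ ⟪ a' , b' , c' ⟫ = a ℤ.* a' ℤ.+ b ℤ.* b' ℤ.+ c ℤ.* c'

colZ₁ colZ₂ colZ₃ : Mat → Z3
colZ₁ h = ⟪ e₁ (row₁ h) , e₁ (row₂ h) , e₁ (row₃ h) ⟫
colZ₂ h = ⟪ e₂ (row₁ h) , e₂ (row₂ h) , e₂ (row₃ h) ⟫
colZ₃ h = ⟪ e₃ (row₁ h) , e₃ (row₂ h) , e₃ (row₃ h) ⟫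

_*M_ : Mat → Mat → Mat
g *M h = mat (r (row₁ g)) (r (row₂ g)) (r (row₃ g))
  where
  r : Z3 → Z3
  r x = ⟪ dotZ x (colZ₁ h) , dotZ x (colZ₂ h) , dotZ x (colZ₃ h) ⟫

I₃ : Mat
I₃ = mat ⟪ ℤ.+ 1 , ℤ.+ 0 , ℤ.+ 0 ⟫ ⟪ ℤ.+ 0 , ℤ.+ 1 , ℤ.+ 0 ⟫ ⟪ ℤ.+ 0 , ℤ.+ 0 , ℤ.+ 1 ⟫

crossZ : Z3 → Z3 → Z3
crossZ ⟪ a , b , c ⟫ ⟪ a' , b' , c' ⟫ =
  ⟪ b ℤ.* c' ℤ.- c ℤ.* b' , c ℤ.* a' ℤ.- a ℤ.* c' , a ℤ.* b' ℤ.- b ℤ.* a' ⟫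

detM : Mat → ℤ
detM g = dotZ (crossZ (row₁ g) (row₂ g)) (row₃ g)

InSL3Z : Mat → Set
InSL3Z g = detM g ≡ ℤ.+ 1

record FiniteIndexSubgroup (Γ : Mat → Set) : Set where
  field
    ⊆SL   : ∀ g → Γ g → InSL3Z g
    one   : Γ I₃
    mul   : ∀ g h → Γ g → Γ h → Γ (g *M h)
    inv   : ∀ g → Γ g → Σ Mat λ h → Γ h × (g *M h ≡ I₃)
    cosetReps : List Mat
    covers : ∀ h → InSL3Z h →
             Data.List.Relation.Unary.Any.Any
               (λ gi → Σ Mat λ γ → Γ γ × (h ≡ gi *M γ)) cosetReps

-- Planes in ℚ³ (for the hypotheses): span of two independent vectors

LinIndep2 : Q3 → Q3 → Set
LinIndep2 a b = ∀ s t → (s ·v a) +v (t ·v b) ≡ 0v → (s ≡ 0ℚ) × (t ≡ 0ℚ)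

InSpan : Q3 → Q3 → Q3 → Set
InSpan a b w = Σ ℚ λ s → Σ ℚ λ t → w ≡ (s ·v a) +v (t ·v b)

-- The Tits building of ℚ³ and its 1-chains.
-- A vertex is a line ⟨u⟩ (u ≠ 0) or a plane, the plane being recorded by
-- a nonzero normal vector n (plane = {w | n·w = 0}).  Nonzero vectors
-- give the same vertex iff they are proportional (cross product 0).
-- An edge (1-simplex) is a flag line ⊂ plane, recorded as (u , n) with
-- n·u = 0, and oriented from the line to the plane.

Flag : Set
Flag = Q3 × Q3

ValidFlag : Flag → Set
ValidFlag (u , n) = (u ≢ 0v) × (n ≢ 0v) × (dot n u ≡ 0ℚ)

Chain : Set
Chain = List (ℚ × Flag)

sumℚ : List ℚ → ℚ
sumℚ = foldr ℚ._+_ 0ℚ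

coeff : Chain → Flag → ℚ
coeff [] f = 0ℚ
coeff ((q , (u' , n')) ∷ c) (u , n) with u' ∥? u | n' ∥? n
... | yes _ | yes _ = q ℚ.+ coeff c (u , n)
... | _     | _     = coeff c (u , n)

lineSum : Chain → Q3 → ℚ
lineSum [] u = 0ℚ
lineSum ((q , (u' , _)) ∷ c) u with u' ∥? u
... | yes _ = q ℚ.+ lineSum c u
... | no _  = lineSum c u

planeSum : Chain → Q3 → ℚ
planeSum [] n = 0ℚ
planeSum ((q , (_ , n')) ∷ c) n with n' ∥? n
... | yes _ = q ℚ.+ planeSum c n
... | no _  = planeSum c n

-- St(ℚ³) = H̃₁ = ker (∂ : C₁ → C₀)  (the building is 1-dimensional)
IsCycle : Chain → Set
IsCycle c = All (λ e → ValidFlag (Data.Product.proj₂ e)) c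
          × (∀ u → u ≢ 0v → lineSum c u ≡ 0ℚ)
          × (∀ n → n ≢ 0v → planeSum c n ≡ 0ℚ)

negC : Chain → Chain
negC = map (λ { (q , f) → (ℚ.- q , f) })

actC : Mat → Chain → Chain
actC g = map (λ { (q , (u , n)) → (q , (g ⊙ u , cof⊙ g n)) })

-- modular symbol [v₁,v₂,v₃]: the hexagon
--  ⟨v₁⟩ – ⟨v₁,v₂⟩ – ⟨v₂⟩ – ⟨v₂,v₃⟩ – ⟨v₃⟩ – ⟨v₃,v₁⟩ – ⟨v₁⟩,
-- zero if v₁,v₂,v₃ are linearly dependent.  (The formula is natural in
-- the vᵢ, hence g[v₁,v₂,v₃] = [gv₁,gv₂,gv₃].)
modSym : Q3 → Q3 → Q3 → Chain
modSym v₁ v₂ v₃ with det3 v₁ v₂ v₃ ≟ℚ 0ℚ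
... | yes _ = []
... | no _ =
  (1ℚ , (v₁ , p₁₂)) ∷ (ℚ.- 1ℚ , (v₂ , p₁₂)) ∷
  (1ℚ , (v₂ , p₂₃)) ∷ (ℚ.- 1ℚ , (v₃ , p₂₃)) ∷
  (1ℚ , (v₃ , p₃₁)) ∷ (ℚ.- 1ℚ , (v₁ , p₃₁)) ∷ []
  where
  p₁₂ = cross v₁ v₂
  p₂₃ = cross v₂ v₃
  p₃₁ = cross v₃ v₁

-- equality of the images in H₀(Γ, St) = St / span_ℚ{ g m − m | g ∈ Γ, m ∈ St }:
-- c − c' is a finite sum of terms g m − m  (ℚ-scalars absorbed into m),
-- equality of chains being equality of coefficients on all flags.
CoinvEq : (Mat → Set) → Chain → Chain → Set
CoinvEq Γ c c' =
  Σ (List (Mat × Chain)) λ L →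
    All (λ p → Γ (Data.Product.proj₁ p) × IsCycle (Data.Product.proj₂ p)) L
    × (∀ f → ValidFlag f →
         coeff c f ℚ.- coeff c' f
           ≡ coeff (concatMap (λ { (g , m) → actC g m ++ negC m }) L) f)

{-# OPTIONS --safe #-}
module Submission where

-- For z fixed and u, w, t in a plane V, the modular symbols satisfy the cocycle relation
-- [u,w,z] + [w,t,z] + [t,u,z] = 0. Each hexagon [u,w,z] is the sum of the three paths
-- u → ⟨u,w⟩ → w, w → ⟨w,z⟩ → z and z → ⟨z,u⟩ → u of the building. The paths through ⟨u,w⟩ = V
-- of the three hexagons form the closed triangle u → V → w → V → t → V → u, and the remaining
-- paths occur in pairs of opposite orientation. A symbol with dependent entries is 0, and when
-- u and w are proportional the other two hexagons cancel in the same way. The cocycle relation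
-- and the antisymmetry it implies give [x,γx,z] − [y,γy,z] = [γy,γx,z] − [y,x,z], which, since
-- γz = ±z and [u,w,−z] = [u,w,z], is γm − m for the cycle m = [y,x,z].

open import Defs
open import Data.Bool using (true; false; if_then_else_; _∧_)
open import Data.Fin using (Fin; zero; suc; _↑ˡ_; _↑ʳ_)
open import Data.Integer as ℤ using (ℤ)
import Data.Integer.Tactic.RingSolver as ℤ-Solver
open import Data.List using ([]; _∷_; _++_)
open import Data.List.Properties using (++-identityʳ)
open import Data.List.Relation.Unary.All using (All) renaming ([] to []ᴬ; _∷_ to _∷ᴬ_)
open import Data.Nat using (ℕ; zero; suc; _*_; _+_)
open import Data.Product using (_×_; _,_; Σ; ∃-syntax; proj₁; proj₂)
open import Data.Rational as ℚ using (ℚ; 0ℚ; 1ℚ; 1/_; ≢-nonZero)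
open import Data.Rational.Properties
  using (_≟_; *-identityˡ; *-identityʳ; *-inverseˡ; *-assoc; *-zeroʳ; +-identityˡ; +-identityʳ; +-assoc;
         toℚᵘ-injective; toℚᵘ-fromℚᵘ; toℚᵘ-homo-+; toℚᵘ-homo-*; toℚᵘ-homo‿-)
open import Data.Rational.Solver using (module +-*-Solver)
import Data.Rational.Unnormalised as ℚᵘ
import Data.Rational.Unnormalised.Properties as ℚᵘ
open import Data.Sum using (_⊎_; inj₁; inj₂; [_,_]′)
open import Data.Vec using (Vec; []; _∷_; tabulate) renaming (_++_ to _++ᵛ_)
open import Data.Empty using (⊥-elim)
open import Function using (mk⇔; _∘_)
open import Relation.Binary.PropositionalEquality using (_≡_; _≢_; refl; sym; trans; cong; cong₂; subst; module ≡-Reasoning)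
open import Relation.Nullary using (¬_; yes; no; does)
open import Relation.Nullary.Decidable using (does-⇔)

open +-*-Solver using (Polynomial; var; con; _:+_; _:*_; _:-_; :-_; ⟦_⟧; ⟦_⟧↓; prove; solve; _:=_)

p*q≡0⇒p≡0∨q≡0 : ∀ p q → p ℚ.* q ≡ 0ℚ → p ≡ 0ℚ ⊎ q ≡ 0ℚ
p*q≡0⇒p≡0∨q≡0 p q pq≡0 with p ≟ 0ℚ
... | yes p≡0 = inj₁ p≡0
... | no p≢0 = inj₂ (begin
  q                      ≡⟨ sym (*-identityˡ q) ⟩
  1ℚ ℚ.* q               ≡⟨ cong (ℚ._* q) (sym (*-inverseˡ p)) ⟩
  (1/ p ℚ.* p) ℚ.* q     ≡⟨ *-assoc (1/ p) p q ⟩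
  1/ p ℚ.* (p ℚ.* q)     ≡⟨ cong (1/ p ℚ.*_) pq≡0 ⟩
  1/ p ℚ.* 0ℚ            ≡⟨ *-zeroʳ (1/ p) ⟩
  0ℚ                     ∎)
  where
  open ≡-Reasoning
  instance _ = ≢-nonZero p≢0

sum-zero : ∀ {p q r} → p ≡ 0ℚ → q ≡ 0ℚ → r ≡ 0ℚ → p ℚ.+ q ℚ.+ r ≡ 0ℚ
sum-zero refl refl refl = refl

+-rotate : ∀ p q r → p ℚ.+ q ℚ.+ r ≡ q ℚ.+ r ℚ.+ p
+-rotate = solve 3 (λ p q r → p :+ q :+ r := q :+ r :+ p) refl

Q3-≡ : ∀ {a b c a′ b′ c′} → a ≡ a′ → b ≡ b′ → c ≡ c′ → ⟨ a , b , c ⟩ ≡ ⟨ a′ , b′ , c′ ⟩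
Q3-≡ refl refl refl = refl

-- Polynomial counterparts of the operations on Q3, built so that their
-- semantics unfolds to those operations definitionally; a vector identity
-- then follows from the ring solver applied to each coordinate.
record Poly³ (n : ℕ) : Set where
  constructor ⟨_,_,_⟩ₚ
  field
    p₁ p₂ p₃ : Polynomial n

module _ {n : ℕ} where

  ⟦_⟧³ : Poly³ n → Vec ℚ n → Q3
  ⟦ ⟨ p , q , r ⟩ₚ ⟧³ ρ = ⟨ ⟦ p ⟧ ρ , ⟦ q ⟧ ρ , ⟦ r ⟧ ρ ⟩

  ⟦_⟧↓³ : Poly³ n → Vec ℚ n → Q3
  ⟦ ⟨ p , q , r ⟩ₚ ⟧↓³ ρ = ⟨ ⟦ p ⟧↓ ρ , ⟦ q ⟧↓ ρ , ⟦ r ⟧↓ ρ ⟩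

  0ₚ : Poly³ n
  0ₚ = ⟨ con 0ℚ , con 0ℚ , con 0ℚ ⟩ₚ

  _+ₚ_ : Poly³ n → Poly³ n → Poly³ n
  ⟨ a , b , c ⟩ₚ +ₚ ⟨ a′ , b′ , c′ ⟩ₚ = ⟨ a :+ a′ , b :+ b′ , c :+ c′ ⟩ₚ

  _·ₚ_ : Polynomial n → Poly³ n → Poly³ n
  s ·ₚ ⟨ a , b , c ⟩ₚ = ⟨ s :* a , s :* b , s :* c ⟩ₚ

  -ₚ_ : Poly³ n → Poly³ n
  -ₚ ⟨ a , b , c ⟩ₚ = ⟨ :- a , :- b , :- c ⟩ₚ

  dotₚ : Poly³ n → Poly³ n → Polynomial n
  dotₚ ⟨ a , b , c ⟩ₚ ⟨ a′ , b′ , c′ ⟩ₚ = ((a :* a′) :+ (b :* b′)) :+ (c :* c′)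

  crossₚ : Poly³ n → Poly³ n → Poly³ n
  crossₚ ⟨ a , b , c ⟩ₚ ⟨ a′ , b′ , c′ ⟩ₚ =
    ⟨ (b :* c′) :- (c :* b′) , (c :* a′) :- (a :* c′) , (a :* b′) :- (b :* a′) ⟩ₚ

  _⊙ₚ_ : Poly³ n × Poly³ n × Poly³ n → Poly³ n → Poly³ n
  (r₁ , r₂ , r₃) ⊙ₚ v = ⟨ dotₚ r₁ v , dotₚ r₂ v , dotₚ r₃ v ⟩ₚ

  cof⊙ₚ : Poly³ n × Poly³ n × Poly³ n → Poly³ n → Poly³ n
  cof⊙ₚ g ⟨ n₁ , n₂ , n₃ ⟩ₚ =
    (n₁ ·ₚ crossₚ g₂ g₃) +ₚ ((n₂ ·ₚ crossₚ g₃ g₁) +ₚ (n₃ ·ₚ crossₚ g₁ g₂))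
    where
    g₁ = g ⊙ₚ ⟨ con 1ℚ , con 0ℚ , con 0ℚ ⟩ₚ
    g₂ = g ⊙ₚ ⟨ con 0ℚ , con 1ℚ , con 0ℚ ⟩ₚ
    g₃ = g ⊙ₚ ⟨ con 0ℚ , con 0ℚ , con 1ℚ ⟩ₚ

environment : ∀ {k m} → Vec Q3 k → Vec ℚ m → Vec ℚ (k * 3 + m)
environment []       ss = ss
environment (v ∷ vs) ss = c₁ v ∷ c₂ v ∷ c₃ v ∷ environment vs ss

coordinate : ∀ {k} m → Fin k → Fin 3 → Fin (k * 3 + m)
coordinate {suc k} m zero    j = j ↑ˡ (k * 3 + m)
coordinate {suc k} m (suc i) j = 3 ↑ʳ coordinate m i j

vectorVariables : ∀ k m → Vec (Poly³ (k * 3 + m)) k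
vectorVariables k m = tabulate λ i →
  ⟨ var (coordinate m i zero) , var (coordinate m i (suc zero)) , var (coordinate m i (suc (suc zero))) ⟩ₚ

scalarVariables : ∀ k m → Vec (Polynomial (k * 3 + m)) m
scalarVariables k m = tabulate λ i → var (k * 3 ↑ʳ i)

module _ {k m : ℕ} (vs : Vec Q3 k) (ss : Vec ℚ m) where

  private
    ρ : Vec ℚ (k * 3 + m)
    ρ = environment vs ss

    Variables : Set → Set
    Variables A = Vec (Poly³ (k * 3 + m)) k → Vec (Polynomial (k * 3 + m)) m → A × A

  vector-identity : (f : Variables (Poly³ (k * 3 + m))) →
    let (L , R) = f (vectorVariables k m) (scalarVariables k m) in
    ⟦ L ⟧↓³ ρ ≡ ⟦ R ⟧↓³ ρ → ⟦ L ⟧³ ρ ≡ ⟦ R ⟧³ ρ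
  vector-identity f eq =
    Q3-≡ (prove ρ (p₁ L) (p₁ R) (cong c₁ eq)) (prove ρ (p₂ L) (p₂ R) (cong c₂ eq)) (prove ρ (p₃ L) (p₃ R) (cong c₃ eq))
    where
    open Poly³
    L R : Poly³ (k * 3 + m)
    L = proj₁ (f (vectorVariables k m) (scalarVariables k m))
    R = proj₂ (f (vectorVariables k m) (scalarVariables k m))

  scalar-identity : (f : Variables (Polynomial (k * 3 + m))) →
    let (L , R) = f (vectorVariables k m) (scalarVariables k m) in
    ⟦ L ⟧↓ ρ ≡ ⟦ R ⟧↓ ρ → ⟦ L ⟧ ρ ≡ ⟦ R ⟧ ρ
  scalar-identity f = prove ρ (proj₁ (f (vectorVariables k m) (scalarVariables k m)))
                              (proj₂ (f (vectorVariables k m) (scalarVariables k m)))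

ê₁ ê₂ ê₃ : Q3
ê₁ = ⟨ 1ℚ , 0ℚ , 0ℚ ⟩
ê₂ = ⟨ 0ℚ , 1ℚ , 0ℚ ⟩
ê₃ = ⟨ 0ℚ , 0ℚ , 1ℚ ⟩

coordinates : ∀ v → ⟨ dot ê₁ v , dot ê₂ v , dot ê₃ v ⟩ ≡ v
coordinates v = vector-identity (v ∷ []) [] (λ { (v ∷ []) [] → ⟨ dotₚ ê₁ₚ v , dotₚ ê₂ₚ v , dotₚ ê₃ₚ v ⟩ₚ , v }) refl
  where
  ê₁ₚ ê₂ₚ ê₃ₚ : Poly³ 3
  ê₁ₚ = ⟨ con 1ℚ , con 0ℚ , con 0ℚ ⟩ₚ
  ê₂ₚ = ⟨ con 0ℚ , con 1ℚ , con 0ℚ ⟩ₚ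
  ê₃ₚ = ⟨ con 0ℚ , con 0ℚ , con 1ℚ ⟩ₚ

cross-self : ∀ u → cross u u ≡ 0v
cross-self u = vector-identity (u ∷ []) [] (λ { (u ∷ []) [] → crossₚ u u , 0ₚ }) refl

cross-anticomm : ∀ u v → cross v u ≡ -v cross u v
cross-anticomm u v = vector-identity (u ∷ v ∷ []) [] (λ { (u ∷ v ∷ []) [] → crossₚ v u , -ₚ crossₚ u v }) refl

cross-zeroˡ : ∀ v → cross 0v v ≡ 0v
cross-zeroˡ v = vector-identity (v ∷ []) [] (λ { (v ∷ []) [] → crossₚ 0ₚ v , 0ₚ }) refl

cross-negˡ : ∀ u v → cross (-v u) v ≡ -v cross u v
cross-negˡ u v = vector-identity (u ∷ v ∷ []) [] (λ { (u ∷ v ∷ []) [] → crossₚ (-ₚ u) v , -ₚ crossₚ u v }) refl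

cross-negʳ : ∀ u v → cross u (-v v) ≡ -v cross u v
cross-negʳ u v = vector-identity (u ∷ v ∷ []) [] (λ { (u ∷ v ∷ []) [] → crossₚ u (-ₚ v) , -ₚ crossₚ u v }) refl

-v-involutive : ∀ v → -v (-v v) ≡ v
-v-involutive v = vector-identity (v ∷ []) [] (λ { (v ∷ []) [] → -ₚ (-ₚ v) , v }) refl

·v-zeroˡ : ∀ v → 0ℚ ·v v ≡ 0v
·v-zeroˡ v = vector-identity (v ∷ []) [] (λ { (v ∷ []) [] → con 0ℚ ·ₚ v , 0ₚ }) refl

cross-·v-self : ∀ s v → cross (s ·v v) v ≡ 0v
cross-·v-self s v = vector-identity (v ∷ []) (s ∷ []) (λ { (v ∷ []) (s ∷ []) → crossₚ (s ·ₚ v) v , 0ₚ }) refl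

dot-zeroˡ : ∀ v → dot 0v v ≡ 0ℚ
dot-zeroˡ v = scalar-identity (v ∷ []) [] (λ { (v ∷ []) [] → dotₚ 0ₚ v , con 0ℚ }) refl

dot-zeroʳ : ∀ v → dot v 0v ≡ 0ℚ
dot-zeroʳ v = scalar-identity (v ∷ []) [] (λ { (v ∷ []) [] → dotₚ v 0ₚ , con 0ℚ }) refl

dot-·vˡ : ∀ s u v → dot (s ·v u) v ≡ s ℚ.* dot u v
dot-·vˡ s u v = scalar-identity (u ∷ v ∷ []) (s ∷ []) (λ { (u ∷ v ∷ []) (s ∷ []) → dotₚ (s ·ₚ u) v , s :* dotₚ u v }) refl

dot-crossˡ : ∀ u v → dot (cross u v) u ≡ 0ℚ
dot-crossˡ u v = scalar-identity (u ∷ v ∷ []) [] (λ { (u ∷ v ∷ []) [] → dotₚ (crossₚ u v) u , con 0ℚ }) refl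

dot-crossʳ : ∀ u v → dot (cross u v) v ≡ 0ℚ
dot-crossʳ u v = scalar-identity (u ∷ v ∷ []) [] (λ { (u ∷ v ∷ []) [] → dotₚ (crossₚ u v) v , con 0ℚ }) refl

det3-rotate : ∀ u v w → det3 u v w ≡ det3 v w u
det3-rotate u v w = scalar-identity (u ∷ v ∷ w ∷ []) [] (λ { (u ∷ v ∷ w ∷ []) [] → dotₚ (crossₚ u v) w , dotₚ (crossₚ v w) u }) refl

det3-negʳ : ∀ u v w → det3 u v (-v w) ≡ ℚ.- det3 u v w
det3-negʳ u v w = scalar-identity (u ∷ v ∷ w ∷ []) [] (λ { (u ∷ v ∷ w ∷ []) [] → dotₚ (crossₚ u v) (-ₚ w) , :- dotₚ (crossₚ u v) w }) refl

cross-in-span : ∀ a b s t s′ t′ → cross ((s ·v a) +v (t ·v b)) ((s′ ·v a) +v (t′ ·v b)) ≡ (s ℚ.* t′ ℚ.- t ℚ.* s′) ·v cross a b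
cross-in-span a b s t s′ t′ = vector-identity (a ∷ b ∷ []) (s ∷ t ∷ s′ ∷ t′ ∷ [])
  (λ { (a ∷ b ∷ []) (s ∷ t ∷ s′ ∷ t′ ∷ []) → crossₚ ((s ·ₚ a) +ₚ (t ·ₚ b)) ((s′ ·ₚ a) +ₚ (t′ ·ₚ b)) , ((s :* t′) :- (t :* s′)) ·ₚ crossₚ a b })
  refl

cross-cross-common : ∀ u v w → cross (cross u w) (cross v w) ≡ det3 u v w ·v w
cross-cross-common u v w = vector-identity (u ∷ v ∷ w ∷ []) []
  (λ { (u ∷ v ∷ w ∷ []) [] → crossₚ (crossₚ u w) (crossₚ v w) , dotₚ (crossₚ u v) w ·ₚ w }) refl

cofactor-expansion : ∀ a b c e → (dot e a ·v cross b c) +v ((dot e b ·v cross c a) +v (dot e c ·v cross a b)) ≡ det3 a b c ·v e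
cofactor-expansion a b c e = vector-identity (a ∷ b ∷ c ∷ e ∷ []) []
  (λ { (a ∷ b ∷ c ∷ e ∷ []) [] → (dotₚ e a ·ₚ crossₚ b c) +ₚ ((dotₚ e b ·ₚ crossₚ c a) +ₚ (dotₚ e c ·ₚ crossₚ a b)) , dotₚ (crossₚ a b) c ·ₚ e })
  refl

infix 4 _∥_ _∼_

record _∥_ (u v : Q3) : Set where
  constructor ∥-intro
  field
    cross≡0 : cross u v ≡ 0v
open _∥_

_∼_ : Q3 → Q3 → Set
u ∼ v = u ≢ 0v × v ≢ 0v × u ∥ v

-v-≢0 : ∀ {v} → v ≢ 0v → -v v ≢ 0v
-v-≢0 {v} v≢0 -v≡0 = v≢0 (trans (sym (-v-involutive v)) (cong -v_ -v≡0))

∥-sym : ∀ {u v} → u ∥ v → v ∥ u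
∥-sym {u} {v} (∥-intro u×v≡0) = ∥-intro (trans (cross-anticomm u v) (cong -v_ u×v≡0))

cross≢0-swap : ∀ {u v} → cross u v ≢ 0v → cross v u ≢ 0v
cross≢0-swap {u} {v} u×v≢0 v×u≡0 = u×v≢0 (cross≡0 (∥-sym {v} {u} (∥-intro v×u≡0)))

·v-cancel : ∀ {s v} → s ≢ 0ℚ → s ·v v ≡ 0v → v ≡ 0v
·v-cancel {s} {v} s≢0 sv≡0 = Q3-≡ (cancel (cong c₁ sv≡0)) (cancel (cong c₂ sv≡0)) (cancel (cong c₃ sv≡0))
  where
  cancel : ∀ {x} → s ℚ.* x ≡ 0ℚ → x ≡ 0ℚ
  cancel {x} sx≡0 with p*q≡0⇒p≡0∨q≡0 s x sx≡0
  ... | inj₁ s≡0 = ⊥-elim (s≢0 s≡0)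
  ... | inj₂ x≡0 = x≡0

nonzero-coordinate : ∀ {v} → v ≢ 0v → ∃[ e ] dot e v ≢ 0ℚ
nonzero-coordinate {v} v≢0 with dot ê₁ v ≟ 0ℚ | dot ê₂ v ≟ 0ℚ | dot ê₃ v ≟ 0ℚ
... | no v₁≢0 | _        | _        = ê₁ , v₁≢0
... | yes _   | no v₂≢0  | _        = ê₂ , v₂≢0
... | yes _   | yes _    | no v₃≢0  = ê₃ , v₃≢0
... | yes v₁≡0 | yes v₂≡0 | yes v₃≡0 = ⊥-elim (v≢0 (trans (sym (coordinates v)) (Q3-≡ v₁≡0 v₂≡0 v₃≡0)))

∥-trans : ∀ {u v w} → v ≢ 0v → u ∥ v → v ∥ w → u ∥ w
∥-trans {u} {v} {w} v≢0 (∥-intro u×v≡0) (∥-intro v×w≡0) with nonzero-coordinate v≢0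
... | e , e·v≢0 = ∥-sym (∥-intro (·v-cancel e·v≢0 (begin
  dot e v ·v cross w u
    ≡⟨ sym (absorb-zeros (dot e u) (dot e w) (dot e v ·v cross w u)) ⟩
  (dot e u ·v 0v) +v ((dot e v ·v cross w u) +v (dot e w ·v 0v))
    ≡⟨ cong₂ (λ p q → (dot e u ·v p) +v ((dot e v ·v cross w u) +v (dot e w ·v q))) (sym v×w≡0) (sym u×v≡0) ⟩
  (dot e u ·v cross v w) +v ((dot e v ·v cross w u) +v (dot e w ·v cross u v))
    ≡⟨ cofactor-expansion u v w e ⟩
  det3 u v w ·v e
    ≡⟨ cong (λ n → dot n w ·v e) u×v≡0 ⟩
  dot 0v w ·v e
    ≡⟨ cong (_·v e) (dot-zeroˡ w) ⟩
  0ℚ ·v e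
    ≡⟨ ·v-zeroˡ e ⟩
  0v ∎)))
  where
  open ≡-Reasoning
  absorb-zeros : ∀ s t x → (s ·v 0v) +v (x +v (t ·v 0v)) ≡ x
  absorb-zeros s t x = vector-identity (x ∷ []) (s ∷ t ∷ [])
    (λ { (x ∷ []) (s ∷ t ∷ []) → (s ·ₚ 0ₚ) +ₚ (x +ₚ (t ·ₚ 0ₚ)) , x }) refl

∼-refl : ∀ {v} → v ≢ 0v → v ∼ v
∼-refl {v} v≢0 = v≢0 , v≢0 , ∥-intro (cross-self v)

∼-sym : ∀ {u v} → u ∼ v → v ∼ u
∼-sym (u≢0 , v≢0 , u∥v) = v≢0 , u≢0 , ∥-sym u∥v

∥-resp-∼ : ∀ {u u′ w} → u ∼ u′ → u ∥ w → u′ ∥ w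
∥-resp-∼ (u≢0 , _ , u∥u′) = ∥-trans u≢0 (∥-sym u∥u′)

-v-∼ : ∀ {v} → v ≢ 0v → -v v ∼ v
-v-∼ {v} v≢0 = -v-≢0 v≢0 , v≢0 , ∥-intro (trans (cross-negˡ v v) (cong -v_ (cross-self v)))

toℚᵘ-toℚ : ∀ a → ℚ.toℚᵘ (toℚ a) ℚᵘ.≃ ℚᵘ.mkℚᵘ a 0
toℚᵘ-toℚ a = toℚᵘ-fromℚᵘ (ℚᵘ.mkℚᵘ a 0)

toℚ-+ : ∀ a b → toℚ (a ℤ.+ b) ≡ toℚ a ℚ.+ toℚ b
toℚ-+ a b = toℚᵘ-injective (begin
  ℚ.toℚᵘ (toℚ (a ℤ.+ b))                ≈⟨ toℚᵘ-toℚ (a ℤ.+ b) ⟩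
  ℚᵘ.mkℚᵘ (a ℤ.+ b) 0                    ≈⟨ ℚᵘ.*≡* (identity a b) ⟩
  ℚᵘ.mkℚᵘ a 0 ℚᵘ.+ ℚᵘ.mkℚᵘ b 0           ≈⟨ ℚᵘ.+-cong (toℚᵘ-toℚ a) (toℚᵘ-toℚ b) ⟨
  ℚ.toℚᵘ (toℚ a) ℚᵘ.+ ℚ.toℚᵘ (toℚ b)     ≈⟨ toℚᵘ-homo-+ (toℚ a) (toℚ b) ⟨
  ℚ.toℚᵘ (toℚ a ℚ.+ toℚ b)               ∎)
  where
  open ℚᵘ.≃-Reasoning
  identity : ∀ a b → (a ℤ.+ b) ℤ.* ℤ.+ 1 ≡ (a ℤ.* ℤ.+ 1 ℤ.+ b ℤ.* ℤ.+ 1) ℤ.* ℤ.+ 1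
  identity = ℤ-Solver.solve-∀

toℚ-* : ∀ a b → toℚ (a ℤ.* b) ≡ toℚ a ℚ.* toℚ b
toℚ-* a b = toℚᵘ-injective (begin
  ℚ.toℚᵘ (toℚ (a ℤ.* b))                ≈⟨ toℚᵘ-toℚ (a ℤ.* b) ⟩
  ℚᵘ.mkℚᵘ (a ℤ.* b) 0                    ≈⟨ ℚᵘ.*≡* refl ⟩
  ℚᵘ.mkℚᵘ a 0 ℚᵘ.* ℚᵘ.mkℚᵘ b 0           ≈⟨ ℚᵘ.*-cong (toℚᵘ-toℚ a) (toℚᵘ-toℚ b) ⟨
  ℚ.toℚᵘ (toℚ a) ℚᵘ.* ℚ.toℚᵘ (toℚ b)     ≈⟨ toℚᵘ-homo-* (toℚ a) (toℚ b) ⟨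
  ℚ.toℚᵘ (toℚ a ℚ.* toℚ b)               ∎)
  where open ℚᵘ.≃-Reasoning

toℚ-neg : ∀ a → toℚ (ℤ.- a) ≡ ℚ.- toℚ a
toℚ-neg a = toℚᵘ-injective (begin
  ℚ.toℚᵘ (toℚ (ℤ.- a))       ≈⟨ toℚᵘ-toℚ (ℤ.- a) ⟩
  ℚᵘ.- ℚᵘ.mkℚᵘ a 0           ≈⟨ ℚᵘ.-‿cong (toℚᵘ-toℚ a) ⟨
  ℚᵘ.- ℚ.toℚᵘ (toℚ a)        ≈⟨ toℚᵘ-homo‿- (toℚ a) ⟨
  ℚ.toℚᵘ (ℚ.- toℚ a)         ∎)
  where open ℚᵘ.≃-Reasoning

toℚ-dotZ : ∀ x y → toℚ (dotZ x y) ≡ dot (rowQ x) (rowQ y)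
toℚ-dotZ ⟪ a , b , c ⟫ ⟪ a′ , b′ , c′ ⟫ = begin
  toℚ (a ℤ.* a′ ℤ.+ b ℤ.* b′ ℤ.+ c ℤ.* c′)
    ≡⟨ toℚ-+ (a ℤ.* a′ ℤ.+ b ℤ.* b′) (c ℤ.* c′) ⟩
  toℚ (a ℤ.* a′ ℤ.+ b ℤ.* b′) ℚ.+ toℚ (c ℤ.* c′)
    ≡⟨ cong₂ ℚ._+_ (toℚ-+ (a ℤ.* a′) (b ℤ.* b′)) (toℚ-* c c′) ⟩
  toℚ (a ℤ.* a′) ℚ.+ toℚ (b ℤ.* b′) ℚ.+ toℚ c ℚ.* toℚ c′
    ≡⟨ cong₂ (λ p q → p ℚ.+ q ℚ.+ toℚ c ℚ.* toℚ c′) (toℚ-* a a′) (toℚ-* b b′) ⟩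
  dot (rowQ ⟪ a , b , c ⟫) (rowQ ⟪ a′ , b′ , c′ ⟫) ∎
  where open ≡-Reasoning

rowQ-crossZ : ∀ x y → rowQ (crossZ x y) ≡ cross (rowQ x) (rowQ y)
rowQ-crossZ ⟪ a , b , c ⟫ ⟪ a′ , b′ , c′ ⟫ = Q3-≡ (toℚ-minor b c′ c b′) (toℚ-minor c a′ a c′) (toℚ-minor a b′ b a′)
  where
  toℚ-minor : ∀ p q r s → toℚ (p ℤ.* q ℤ.- r ℤ.* s) ≡ toℚ p ℚ.* toℚ q ℚ.- toℚ r ℚ.* toℚ s
  toℚ-minor p q r s = trans (toℚ-+ (p ℤ.* q) (ℤ.- (r ℤ.* s)))
    (cong₂ ℚ._+_ (toℚ-* p q) (trans (toℚ-neg (r ℤ.* s)) (cong ℚ.-_ (toℚ-* r s))))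

rows : Mat → Vec Q3 3
rows g = rowQ (row₁ g) ∷ rowQ (row₂ g) ∷ rowQ (row₃ g) ∷ []

det-rows : Mat → ℚ
det-rows g = det3 (rowQ (row₁ g)) (rowQ (row₂ g)) (rowQ (row₃ g))

det-rows-SL : ∀ g → InSL3Z g → det-rows g ≡ 1ℚ
det-rows-SL g detM≡1 = begin
  det-rows g             ≡⟨ cong (λ n → dot n (rowQ (row₃ g))) (rowQ-crossZ (row₁ g) (row₂ g)) ⟨
  dot (rowQ (crossZ (row₁ g) (row₂ g))) (rowQ (row₃ g)) ≡⟨ toℚ-dotZ (crossZ (row₁ g) (row₂ g)) (row₃ g) ⟨
  toℚ (detM g)           ≡⟨ cong toℚ detM≡1 ⟩
  1ℚ                     ∎
  where open ≡-Reasoning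

cof⊙-cross : ∀ g u w → cof⊙ g (cross u w) ≡ cross (g ⊙ u) (g ⊙ w)
cof⊙-cross g u w = vector-identity (rows g ++ᵛ u ∷ w ∷ []) []
  (λ { (r₁ ∷ r₂ ∷ r₃ ∷ u ∷ w ∷ []) [] → let g = (r₁ , r₂ , r₃) in cof⊙ₚ g (crossₚ u w) , crossₚ (g ⊙ₚ u) (g ⊙ₚ w) })
  refl

cof⊙-dot-⊙ : ∀ g n w → dot (cof⊙ g n) (g ⊙ w) ≡ det-rows g ℚ.* dot n w
cof⊙-dot-⊙ g n w = scalar-identity (rows g ++ᵛ n ∷ w ∷ []) []
  (λ { (r₁ ∷ r₂ ∷ r₃ ∷ n ∷ w ∷ []) [] → let g = (r₁ , r₂ , r₃) in dotₚ (cof⊙ₚ g n) (g ⊙ₚ w) , dotₚ (crossₚ r₁ r₂) r₃ :* dotₚ n w })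
  refl

det3-⊙ : ∀ g u v w → det3 (g ⊙ u) (g ⊙ v) (g ⊙ w) ≡ det-rows g ℚ.* det3 u v w
det3-⊙ g u v w = trans (cong (λ n → dot n (g ⊙ w)) (sym (cof⊙-cross g u v))) (cof⊙-dot-⊙ g (cross u v) w)

⊙-≢0 : ∀ g {v} → det-rows g ≢ 0ℚ → v ≢ 0v → g ⊙ v ≢ 0v
⊙-≢0 g {v} det≢0 v≢0 gv≡0 = [ det≢0 , e·v≢0 ]′ (p*q≡0⇒p≡0∨q≡0 (det-rows g) (dot e v) det*e·v≡0)
  where
  open ≡-Reasoning
  e : Q3
  e = proj₁ (nonzero-coordinate v≢0)
  e·v≢0 : dot e v ≢ 0ℚ
  e·v≢0 = proj₂ (nonzero-coordinate v≢0)
  det*e·v≡0 : det-rows g ℚ.* dot e v ≡ 0ℚ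
  det*e·v≡0 = begin
    det-rows g ℚ.* dot e v     ≡⟨ cof⊙-dot-⊙ g e v ⟨
    dot (cof⊙ g e) (g ⊙ v)     ≡⟨ cong (dot (cof⊙ g e)) gv≡0 ⟩
    dot (cof⊙ g e) 0v          ≡⟨ dot-zeroʳ (cof⊙ g e) ⟩
    0ℚ                         ∎

-- the coefficient of f in the chain 1·f′
δ : Flag → Flag → ℚ
δ (u′ , n′) (u , n) = if does (u′ ∥? u) ∧ does (n′ ∥? n) then 1ℚ else 0ℚ

coeff-∷ : ∀ q f′ c f → coeff ((q , f′) ∷ c) f ≡ q ℚ.* δ f′ f ℚ.+ coeff c f
coeff-∷ q (u′ , n′) c (u , n) with u′ ∥? u | n′ ∥? n
... | yes _ | yes _ = cong (ℚ._+ coeff c (u , n)) (sym (*-identityʳ q))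
... | yes _ | no _  = sym (trans (cong (ℚ._+ coeff c (u , n)) (*-zeroʳ q)) (+-identityˡ (coeff c (u , n))))
... | no _  | _     = sym (trans (cong (ℚ._+ coeff c (u , n)) (*-zeroʳ q)) (+-identityˡ (coeff c (u , n))))

coeff-++ : ∀ c d f → coeff (c ++ d) f ≡ coeff c f ℚ.+ coeff d f
coeff-++ [] d f = sym (+-identityˡ (coeff d f))
coeff-++ ((q , f′) ∷ c) d f = begin
  coeff ((q , f′) ∷ c ++ d) f                          ≡⟨ coeff-∷ q f′ (c ++ d) f ⟩
  q ℚ.* δ f′ f ℚ.+ coeff (c ++ d) f                    ≡⟨ cong (q ℚ.* δ f′ f ℚ.+_) (coeff-++ c d f) ⟩
  q ℚ.* δ f′ f ℚ.+ (coeff c f ℚ.+ coeff d f)           ≡⟨ +-assoc (q ℚ.* δ f′ f) (coeff c f) (coeff d f) ⟨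
  q ℚ.* δ f′ f ℚ.+ coeff c f ℚ.+ coeff d f             ≡⟨ cong (ℚ._+ coeff d f) (coeff-∷ q f′ c f) ⟨
  coeff ((q , f′) ∷ c) f ℚ.+ coeff d f                 ∎
  where open ≡-Reasoning

coeff-negC : ∀ c f → coeff (negC c) f ≡ ℚ.- coeff c f
coeff-negC [] f = refl
coeff-negC ((q , f′) ∷ c) f = begin
  coeff (negC ((q , f′) ∷ c)) f                   ≡⟨ coeff-∷ (ℚ.- q) f′ (negC c) f ⟩
  (ℚ.- q) ℚ.* δ f′ f ℚ.+ coeff (negC c) f         ≡⟨ cong ((ℚ.- q) ℚ.* δ f′ f ℚ.+_) (coeff-negC c f) ⟩
  (ℚ.- q) ℚ.* δ f′ f ℚ.+ ℚ.- coeff c f            ≡⟨ solve 3 (λ q d x → (:- q) :* d :+ :- x := :- (q :* d :+ x)) refl q (δ f′ f) (coeff c f) ⟩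
  ℚ.- (q ℚ.* δ f′ f ℚ.+ coeff c f)                ≡⟨ cong ℚ.-_ (coeff-∷ q f′ c f) ⟨
  ℚ.- coeff ((q , f′) ∷ c) f                      ∎
  where open ≡-Reasoning

lineSum-∷ : ∀ q v n c u → lineSum ((q , (v , n)) ∷ c) u ≡ (if does (v ∥? u) then q else 0ℚ) ℚ.+ lineSum c u
lineSum-∷ q v n c u with v ∥? u
... | yes _ = refl
... | no _  = sym (+-identityˡ (lineSum c u))

planeSum-∷ : ∀ q v n c m → planeSum ((q , (v , n)) ∷ c) m ≡ (if does (n ∥? m) then q else 0ℚ) ℚ.+ planeSum c m
planeSum-∷ q v n c m with n ∥? m
... | yes _ = refl
... | no _  = sym (+-identityˡ (planeSum c m))

if-cancel : ∀ b q s → (if b then q else 0ℚ) ℚ.+ ((if b then ℚ.- q else 0ℚ) ℚ.+ s) ≡ s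
if-cancel true  q s = solve 2 (λ q s → q :+ (:- q :+ s) := s) refl q s
if-cancel false q s = trans (+-identityˡ (0ℚ ℚ.+ s)) (+-identityˡ s)

lineSum-cancel : ∀ q v n n′ c u → lineSum ((q , (v , n)) ∷ (ℚ.- q , (v , n′)) ∷ c) u ≡ lineSum c u
lineSum-cancel q v n n′ c u = begin
  lineSum ((q , (v , n)) ∷ (ℚ.- q , (v , n′)) ∷ c) u            ≡⟨ lineSum-∷ q v n _ u ⟩
  [ q ] ℚ.+ lineSum ((ℚ.- q , (v , n′)) ∷ c) u                  ≡⟨ cong ([ q ] ℚ.+_) (lineSum-∷ (ℚ.- q) v n′ c u) ⟩
  [ q ] ℚ.+ ([ ℚ.- q ] ℚ.+ lineSum c u)                          ≡⟨ if-cancel (does (v ∥? u)) q (lineSum c u) ⟩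
  lineSum c u                                                    ∎
  where
  open ≡-Reasoning
  [_] : ℚ → ℚ
  [ p ] = if does (v ∥? u) then p else 0ℚ

planeSum-cancel : ∀ q v v′ n c m → planeSum ((q , (v , n)) ∷ (ℚ.- q , (v′ , n)) ∷ c) m ≡ planeSum c m
planeSum-cancel q v v′ n c m = begin
  planeSum ((q , (v , n)) ∷ (ℚ.- q , (v′ , n)) ∷ c) m           ≡⟨ planeSum-∷ q v n _ m ⟩
  [ q ] ℚ.+ planeSum ((ℚ.- q , (v′ , n)) ∷ c) m                 ≡⟨ cong ([ q ] ℚ.+_) (planeSum-∷ (ℚ.- q) v′ n c m) ⟩
  [ q ] ℚ.+ ([ ℚ.- q ] ℚ.+ planeSum c m)                         ≡⟨ if-cancel (does (n ∥? m)) q (planeSum c m) ⟩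
  planeSum c m                                                   ∎
  where
  open ≡-Reasoning
  [_] : ℚ → ℚ
  [ p ] = if does (n ∥? m) then p else 0ℚ

lineSum-∷-cong : ∀ q v n {c c′} u → lineSum c u ≡ lineSum c′ u → lineSum ((q , (v , n)) ∷ c) u ≡ lineSum ((q , (v , n)) ∷ c′) u
lineSum-∷-cong q v n {c} {c′} u eq = begin
  lineSum ((q , (v , n)) ∷ c) u     ≡⟨ lineSum-∷ q v n c u ⟩
  [q] ℚ.+ lineSum c u               ≡⟨ cong ([q] ℚ.+_) eq ⟩
  [q] ℚ.+ lineSum c′ u              ≡⟨ lineSum-∷ q v n c′ u ⟨
  lineSum ((q , (v , n)) ∷ c′) u    ∎
  where
  open ≡-Reasoning
  [q] : ℚ
  [q] = if does (v ∥? u) then q else 0ℚ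

hexagon : Q3 → Q3 → Q3 → Chain
hexagon v₁ v₂ v₃ =
  (1ℚ , (v₁ , cross v₁ v₂)) ∷ (ℚ.- 1ℚ , (v₂ , cross v₁ v₂)) ∷
  (1ℚ , (v₂ , cross v₂ v₃)) ∷ (ℚ.- 1ℚ , (v₃ , cross v₂ v₃)) ∷
  (1ℚ , (v₃ , cross v₃ v₁)) ∷ (ℚ.- 1ℚ , (v₁ , cross v₃ v₁)) ∷ []

actC-hexagon : ∀ g u v w → actC g (hexagon u v w) ≡ hexagon (g ⊙ u) (g ⊙ v) (g ⊙ w)
actC-hexagon g u v w = with-normals (cof⊙-cross g u v) (cof⊙-cross g v w) (cof⊙-cross g w u)
  where
  with-normals : ∀ {p q r} → p ≡ cross (g ⊙ u) (g ⊙ v) → q ≡ cross (g ⊙ v) (g ⊙ w) → r ≡ cross (g ⊙ w) (g ⊙ u) →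
    (1ℚ , (g ⊙ u , p)) ∷ (ℚ.- 1ℚ , (g ⊙ v , p)) ∷ (1ℚ , (g ⊙ v , q)) ∷ (ℚ.- 1ℚ , (g ⊙ w , q)) ∷
    (1ℚ , (g ⊙ w , r)) ∷ (ℚ.- 1ℚ , (g ⊙ u , r)) ∷ [] ≡ hexagon (g ⊙ u) (g ⊙ v) (g ⊙ w)
  with-normals refl refl refl = refl

modSym-degenerate : ∀ u v w → det3 u v w ≡ 0ℚ → modSym u v w ≡ []
modSym-degenerate u v w det≡0 with det3 u v w ≟ 0ℚ
... | yes _     = refl
... | no det≢0  = ⊥-elim (det≢0 det≡0)

modSym-nondegenerate : ∀ u v w → det3 u v w ≢ 0ℚ → modSym u v w ≡ hexagon u v w
modSym-nondegenerate u v w det≢0 with det3 u v w ≟ 0ℚ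
... | yes det≡0 = ⊥-elim (det≢0 det≡0)
... | no _      = refl

record Nondegenerate (v₁ v₂ v₃ : Q3) : Set where
  field
    v₁≢0 : v₁ ≢ 0v
    v₂≢0 : v₂ ≢ 0v
    v₃≢0 : v₃ ≢ 0v
    v₁×v₂≢0 : cross v₁ v₂ ≢ 0v
    v₂×v₃≢0 : cross v₂ v₃ ≢ 0v
    v₃×v₁≢0 : cross v₃ v₁ ≢ 0v

det≢0⇒nondegenerate : ∀ u v w → det3 u v w ≢ 0ℚ → Nondegenerate u v w
det≢0⇒nondegenerate u v w det≢0 = record
  { v₁≢0 = nonzero-factor u×v≢0
  ; v₂≢0 = nonzero-factor v×w≢0
  ; v₃≢0 = nonzero-factor w×u≢0
  ; v₁×v₂≢0 = u×v≢0
  ; v₂×v₃≢0 = v×w≢0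
  ; v₃×v₁≢0 = w×u≢0
  }
  where
  cross≢0 : ∀ a b c → det3 a b c ≢ 0ℚ → cross a b ≢ 0v
  cross≢0 a b c det≢0 a×b≡0 = det≢0 (trans (cong (λ n → dot n c) a×b≡0) (dot-zeroˡ c))
  u×v≢0 : cross u v ≢ 0v
  u×v≢0 = cross≢0 u v w det≢0
  v×w≢0 : cross v w ≢ 0v
  v×w≢0 = cross≢0 v w u (det≢0 ∘ trans (det3-rotate u v w))
  w×u≢0 : cross w u ≢ 0v
  w×u≢0 = cross≢0 w u v (det≢0 ∘ trans (trans (det3-rotate u v w) (det3-rotate v w u)))
  nonzero-factor : ∀ {a b} → cross a b ≢ 0v → a ≢ 0v
  nonzero-factor {b = b} a×b≢0 refl = a×b≢0 (cross-zeroˡ b)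

δ-resp-∼ : ∀ {u u′ n n′} → u ∼ u′ → n ∼ n′ → ∀ f → δ (u , n) f ≡ δ (u′ , n′) f
δ-resp-∼ u∼u′ n∼n′ (x , m) = cong₂ (λ p q → if p ∧ q then 1ℚ else 0ℚ) (∥?-resp-∼ u∼u′ x) (∥?-resp-∼ n∼n′ m)
  where
  ∥?-resp-∼ : ∀ {a a′} → a ∼ a′ → ∀ b → does (a ∥? b) ≡ does (a′ ∥? b)
  ∥?-resp-∼ {a} {a′} a∼a′ b = does-⇔
    (mk⇔ (λ a×b≡0 → cross≡0 (∥-resp-∼ a∼a′ (∥-intro a×b≡0))) (λ a′×b≡0 → cross≡0 (∥-resp-∼ (∼-sym a∼a′) (∥-intro a′×b≡0))))
    (a ∥? b) (a′ ∥? b)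

-- the edge path p → ⟨p, q⟩ → q of the building
path : Q3 → Q3 → Flag → ℚ
path p q f = δ (p , cross p q) f ℚ.- δ (q , cross p q) f

path-resp-∼ : ∀ {p p′ q q′} → p ∼ p′ → q ∼ q′ → cross p q ∼ cross p′ q′ → ∀ f → path p q f ≡ path p′ q′ f
path-resp-∼ p∼p′ q∼q′ n∼n′ f = cong₂ ℚ._-_ (δ-resp-∼ p∼p′ n∼n′ f) (δ-resp-∼ q∼q′ n∼n′ f)

path-antisym : ∀ {p q} → p ≢ 0v → q ≢ 0v → cross p q ≢ 0v → ∀ f → path p q f ℚ.+ path q p f ≡ 0ℚ
path-antisym {p} {q} p≢0 q≢0 p×q≢0 f = begin
  path p q f ℚ.+ (δ (q , cross q p) f ℚ.- δ (p , cross q p) f)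
    ≡⟨ cong₂ (λ a b → path p q f ℚ.+ (a ℚ.- b)) (δ-resp-∼ (∼-refl q≢0) q×p∼p×q f) (δ-resp-∼ (∼-refl p≢0) q×p∼p×q f) ⟩
  (δ (p , cross p q) f ℚ.- δ (q , cross p q) f) ℚ.+ (δ (q , cross p q) f ℚ.- δ (p , cross p q) f)
    ≡⟨ solve 2 (λ a b → (a :- b) :+ (b :- a) := con 0ℚ) refl (δ (p , cross p q) f) (δ (q , cross p q) f) ⟩
  0ℚ ∎
  where
  open ≡-Reasoning
  q×p∼p×q : cross q p ∼ cross p q
  q×p∼p×q = subst (_∼ cross p q) (sym (cross-anticomm p q)) (-v-∼ p×q≢0)

coeff-hexagon : ∀ u v w f → coeff (hexagon u v w) f ≡ path u v f ℚ.+ path v w f ℚ.+ path w u f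
coeff-hexagon u v w f = begin
  coeff (hexagon u v w) f
    ≡⟨ coeff-segment u v (segment v w (segment w u [])) f ⟩
  path u v f ℚ.+ coeff (segment v w (segment w u [])) f
    ≡⟨ cong (path u v f ℚ.+_) (coeff-segment v w (segment w u []) f) ⟩
  path u v f ℚ.+ (path v w f ℚ.+ coeff (segment w u []) f)
    ≡⟨ cong (λ x → path u v f ℚ.+ (path v w f ℚ.+ x)) (trans (coeff-segment w u [] f) (+-identityʳ (path w u f))) ⟩
  path u v f ℚ.+ (path v w f ℚ.+ path w u f)
    ≡⟨ +-assoc (path u v f) (path v w f) (path w u f) ⟨
  path u v f ℚ.+ path v w f ℚ.+ path w u f ∎
  where
  open ≡-Reasoning
  segment : Q3 → Q3 → Chain → Chain
  segment p q c = (1ℚ , (p , cross p q)) ∷ (ℚ.- 1ℚ , (q , cross p q)) ∷ c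
  coeff-segment : ∀ p q c f → coeff (segment p q c) f ≡ path p q f ℚ.+ coeff c f
  coeff-segment p q c f = begin
    coeff (segment p q c) f
      ≡⟨ coeff-∷ 1ℚ (p , cross p q) ((ℚ.- 1ℚ , (q , cross p q)) ∷ c) f ⟩
    1ℚ ℚ.* δ (p , cross p q) f ℚ.+ coeff ((ℚ.- 1ℚ , (q , cross p q)) ∷ c) f
      ≡⟨ cong (1ℚ ℚ.* δ (p , cross p q) f ℚ.+_) (coeff-∷ (ℚ.- 1ℚ) (q , cross p q) c f) ⟩
    1ℚ ℚ.* δ (p , cross p q) f ℚ.+ ((ℚ.- 1ℚ) ℚ.* δ (q , cross p q) f ℚ.+ coeff c f)
      ≡⟨ solve 3 (λ a b x → con 1ℚ :* a :+ (con (ℚ.- 1ℚ) :* b :+ x) := (a :- b) :+ x) refl (δ (p , cross p q) f) (δ (q , cross p q) f) (coeff c f) ⟩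
    path p q f ℚ.+ coeff c f ∎

coeff-modSym : ∀ u v w → det3 u v w ≢ 0ℚ → ∀ f → coeff (modSym u v w) f ≡ path u v f ℚ.+ path v w f ℚ.+ path w u f
coeff-modSym u v w det≢0 f = trans (cong (λ c → coeff c f) (modSym-nondegenerate u v w det≢0)) (coeff-hexagon u v w f)

coeff-modSym-degenerate : ∀ u v w → det3 u v w ≡ 0ℚ → ∀ f → coeff (modSym u v w) f ≡ 0ℚ
coeff-modSym-degenerate u v w det≡0 f = cong (λ c → coeff c f) (modSym-degenerate u v w det≡0)

hexagon-isCycle : ∀ {u v w} → Nondegenerate u v w → IsCycle (hexagon u v w)
hexagon-isCycle {u} {v} {w} nd = valid-flags , (λ x _ → lineSums x) , (λ m _ → planeSums m)
  where
  open Nondegenerate nd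
  open ≡-Reasoning
  n₁₂ n₂₃ n₃₁ : Q3
  n₁₂ = cross u v
  n₂₃ = cross v w
  n₃₁ = cross w u
  valid-flags : All (λ e → ValidFlag (proj₂ e)) (hexagon u v w)
  valid-flags =
    (v₁≢0 , v₁×v₂≢0 , dot-crossˡ u v) ∷ᴬ (v₂≢0 , v₁×v₂≢0 , dot-crossʳ u v) ∷ᴬ
    (v₂≢0 , v₂×v₃≢0 , dot-crossˡ v w) ∷ᴬ (v₃≢0 , v₂×v₃≢0 , dot-crossʳ v w) ∷ᴬ
    (v₃≢0 , v₃×v₁≢0 , dot-crossˡ w u) ∷ᴬ (v₁≢0 , v₃×v₁≢0 , dot-crossʳ w u) ∷ᴬ []ᴬ
  lineSums : ∀ x → lineSum (hexagon u v w) x ≡ 0ℚ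
  lineSums x = begin
    lineSum (hexagon u v w) x
      ≡⟨ lineSum-∷-cong 1ℚ u n₁₂ x (lineSum-cancel (ℚ.- 1ℚ) v n₁₂ n₂₃ ((ℚ.- 1ℚ , (w , n₂₃)) ∷ (1ℚ , (w , n₃₁)) ∷ (ℚ.- 1ℚ , (u , n₃₁)) ∷ []) x) ⟩
    lineSum ((1ℚ , (u , n₁₂)) ∷ (ℚ.- 1ℚ , (w , n₂₃)) ∷ (1ℚ , (w , n₃₁)) ∷ (ℚ.- 1ℚ , (u , n₃₁)) ∷ []) x
      ≡⟨ lineSum-∷-cong 1ℚ u n₁₂ x (lineSum-cancel (ℚ.- 1ℚ) w n₂₃ n₃₁ ((ℚ.- 1ℚ , (u , n₃₁)) ∷ []) x) ⟩
    lineSum ((1ℚ , (u , n₁₂)) ∷ (ℚ.- 1ℚ , (u , n₃₁)) ∷ []) x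
      ≡⟨ lineSum-cancel 1ℚ u n₁₂ n₃₁ [] x ⟩
    0ℚ ∎
  planeSums : ∀ m → planeSum (hexagon u v w) m ≡ 0ℚ
  planeSums m =
    trans (planeSum-cancel 1ℚ u v n₁₂ ((1ℚ , (v , n₂₃)) ∷ (ℚ.- 1ℚ , (w , n₂₃)) ∷ (1ℚ , (w , n₃₁)) ∷ (ℚ.- 1ℚ , (u , n₃₁)) ∷ []) m)
   (trans (planeSum-cancel 1ℚ v w n₂₃ ((1ℚ , (w , n₃₁)) ∷ (ℚ.- 1ℚ , (u , n₃₁)) ∷ []) m)
          (planeSum-cancel 1ℚ w u n₃₁ [] m))

modSym-isCycle : ∀ u v w → IsCycle (modSym u v w)
modSym-isCycle u v w with det3 u v w ≟ 0ℚ
... | yes _    = []ᴬ , (λ _ _ → refl) , (λ _ _ → refl)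
... | no det≢0 = hexagon-isCycle (det≢0⇒nondegenerate u v w det≢0)

actC-modSym : ∀ g → det-rows g ≢ 0ℚ → ∀ u v w → actC g (modSym u v w) ≡ modSym (g ⊙ u) (g ⊙ v) (g ⊙ w)
actC-modSym g detg≢0 u v w with det3 u v w ≟ 0ℚ | det3 (g ⊙ u) (g ⊙ v) (g ⊙ w) ≟ 0ℚ
... | yes _   | yes _    = refl
... | no _    | no _     = actC-hexagon g u v w
... | yes d≡0 | no gd≢0  = ⊥-elim (gd≢0 (trans (det3-⊙ g u v w) (trans (cong (det-rows g ℚ.*_) d≡0) (*-zeroʳ (det-rows g)))))
... | no d≢0  | yes gd≡0 = ⊥-elim ([ detg≢0 , d≢0 ]′ (p*q≡0⇒p≡0∨q≡0 (det-rows g) (det3 u v w) (trans (sym (det3-⊙ g u v w)) gd≡0)))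

coeff-modSym-negʳ : ∀ u v w f → coeff (modSym u v (-v w)) f ≡ coeff (modSym u v w) f
coeff-modSym-negʳ u v w f with det3 u v w ≟ 0ℚ
... | yes det≡0 = coeff-modSym-degenerate u v (-v w) (trans (det3-negʳ u v w) (cong ℚ.-_ det≡0)) f
... | no det≢0 = begin
  coeff (modSym u v (-v w)) f                         ≡⟨ coeff-modSym u v (-v w) det′≢0 f ⟩
  path u v f ℚ.+ path v (-v w) f ℚ.+ path (-v w) u f  ≡⟨ cong₂ (λ p q → path u v f ℚ.+ p ℚ.+ q) path-v path-u ⟩
  path u v f ℚ.+ path v w f ℚ.+ path w u f            ≡⟨ coeff-hexagon u v w f ⟨
  coeff (hexagon u v w) f                             ∎
  where
  open ≡-Reasoning
  open Nondegenerate (det≢0⇒nondegenerate u v w det≢0)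
  det′≢0 : det3 u v (-v w) ≢ 0ℚ
  det′≢0 det′≡0 = det≢0 (begin
    det3 u v w               ≡⟨ cong (det3 u v) (-v-involutive w) ⟨
    det3 u v (-v (-v w))     ≡⟨ det3-negʳ u v (-v w) ⟩
    ℚ.- det3 u v (-v w)      ≡⟨ cong ℚ.-_ det′≡0 ⟩
    0ℚ                       ∎)
  path-v : path v (-v w) f ≡ path v w f
  path-v = path-resp-∼ (∼-refl v₂≢0) (-v-∼ v₃≢0) (subst (_∼ cross v w) (sym (cross-negʳ v w)) (-v-∼ v₂×v₃≢0)) f
  path-u : path (-v w) u f ≡ path w u f
  path-u = path-resp-∼ (-v-∼ v₃≢0) (∼-refl v₁≢0) (subst (_∼ cross w u) (sym (cross-negˡ w u)) (-v-∼ v₃×v₁≢0)) f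

module Plane (a b z : Q3) where

  N : Q3
  N = cross a b

  D : ℚ
  D = dot N z

  [_,_] : Q3 → Q3 → Flag → ℚ
  [ u , w ] f = coeff (modSym u w z) f

  cross-in-plane : ∀ {u w} → InSpan a b u → InSpan a b w → ∃[ k ] cross u w ≡ k ·v N
  cross-in-plane (s , t , refl) (s′ , t′ , refl) = s ℚ.* t′ ℚ.- t ℚ.* s′ , cross-in-span a b s t s′ t′

  det3-in-plane : ∀ {u w} (u∈V : InSpan a b u) (w∈V : InSpan a b w) → det3 u w z ≡ proj₁ (cross-in-plane u∈V w∈V) ℚ.* D
  det3-in-plane u∈V w∈V = trans (cong (λ n → dot n z) (proj₂ (cross-in-plane u∈V w∈V))) (dot-·vˡ (proj₁ (cross-in-plane u∈V w∈V)) N z)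

  symbol-parallel : ∀ {u w} → u ∥ w → ∀ f → [ u , w ] f ≡ 0ℚ
  symbol-parallel {u} {w} (∥-intro u×w≡0) = coeff-modSym-degenerate u w z (trans (cong (λ n → dot n z) u×w≡0) (dot-zeroˡ z))

  symbol-flat : D ≡ 0ℚ → ∀ {u w} → InSpan a b u → InSpan a b w → ∀ f → [ u , w ] f ≡ 0ℚ
  symbol-flat D≡0 {u} {w} u∈V w∈V = coeff-modSym-degenerate u w z
    (trans (det3-in-plane u∈V w∈V) (trans (cong (proj₁ (cross-in-plane u∈V w∈V) ℚ.*_) D≡0) (*-zeroʳ (proj₁ (cross-in-plane u∈V w∈V)))))

  module _ (D≢0 : D ≢ 0ℚ) where

    N≢0 : N ≢ 0v
    N≢0 N≡0 = D≢0 (trans (cong (λ n → dot n z) N≡0) (dot-zeroˡ z))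

    det3≢0 : ∀ {u w} → InSpan a b u → InSpan a b w → ¬ u ∥ w → det3 u w z ≢ 0ℚ
    det3≢0 {u} {w} u∈V w∈V u∦w det≡0 = [ k≢0 , D≢0 ]′ (p*q≡0⇒p≡0∨q≡0 k D (trans (sym (det3-in-plane u∈V w∈V)) det≡0))
      where
      k : ℚ
      k = proj₁ (cross-in-plane u∈V w∈V)
      k≢0 : k ≢ 0ℚ
      k≢0 k≡0 = u∦w (∥-intro (trans (proj₂ (cross-in-plane u∈V w∈V)) (trans (cong (_·v N) k≡0) (·v-zeroˡ N))))

    cross∼N : ∀ {u w} → InSpan a b u → InSpan a b w → cross u w ≢ 0v → cross u w ∼ N
    cross∼N {u} {w} u∈V w∈V u×w≢0 = u×w≢0 , N≢0 , ∥-intro (begin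
      cross (cross u w) N      ≡⟨ cong (λ n → cross n N) (proj₂ (cross-in-plane u∈V w∈V)) ⟩
      cross (k ·v N) N         ≡⟨ cross-·v-self k N ⟩
      0v                       ∎)
      where
      open ≡-Reasoning
      k : ℚ
      k = proj₁ (cross-in-plane u∈V w∈V)

    path-in-plane : ∀ {u w} → InSpan a b u → InSpan a b w → u ≢ 0v → w ≢ 0v → cross u w ≢ 0v →
                    ∀ f → path u w f ≡ δ (u , N) f ℚ.- δ (w , N) f
    path-in-plane u∈V w∈V u≢0 w≢0 u×w≢0 f =
      cong₂ ℚ._-_ (δ-resp-∼ (∼-refl u≢0) (cross∼N u∈V w∈V u×w≢0) f) (δ-resp-∼ (∼-refl w≢0) (cross∼N u∈V w∈V u×w≢0) f)

    path-triangle : ∀ {u w t} → InSpan a b u → InSpan a b w → InSpan a b t → u ≢ 0v → w ≢ 0v → t ≢ 0v →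
                    cross u w ≢ 0v → cross w t ≢ 0v → cross t u ≢ 0v →
                    ∀ f → path u w f ℚ.+ path w t f ℚ.+ path t u f ≡ 0ℚ
    path-triangle {u} {w} {t} u∈V w∈V t∈V u≢0 w≢0 t≢0 u×w≢0 w×t≢0 t×u≢0 f = begin
      path u w f ℚ.+ path w t f ℚ.+ path t u f
        ≡⟨ cong₂ (λ p q → p ℚ.+ q ℚ.+ path t u f) (path-in-plane u∈V w∈V u≢0 w≢0 u×w≢0 f) (path-in-plane w∈V t∈V w≢0 t≢0 w×t≢0 f) ⟩
      (δ-N u ℚ.- δ-N w) ℚ.+ (δ-N w ℚ.- δ-N t) ℚ.+ path t u f
        ≡⟨ cong (λ p → (δ-N u ℚ.- δ-N w) ℚ.+ (δ-N w ℚ.- δ-N t) ℚ.+ p) (path-in-plane t∈V u∈V t≢0 u≢0 t×u≢0 f) ⟩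
      (δ-N u ℚ.- δ-N w) ℚ.+ (δ-N w ℚ.- δ-N t) ℚ.+ (δ-N t ℚ.- δ-N u)
        ≡⟨ solve 3 (λ p q r → (p :- q) :+ (q :- r) :+ (r :- p) := con 0ℚ) refl (δ-N u) (δ-N w) (δ-N t) ⟩
      0ℚ ∎
      where
      open ≡-Reasoning
      δ-N : Q3 → ℚ
      δ-N v = δ (v , N) f

    cocycle-nonparallel : ∀ {u w t} → InSpan a b u → InSpan a b w → InSpan a b t →
                          ¬ u ∥ w → ¬ w ∥ t → ¬ t ∥ u → ∀ f → [ u , w ] f ℚ.+ [ w , t ] f ℚ.+ [ t , u ] f ≡ 0ℚ
    cocycle-nonparallel {u} {w} {t} u∈V w∈V t∈V u∦w w∦t t∦u f = begin
      [ u , w ] f ℚ.+ [ w , t ] f ℚ.+ [ t , u ] f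
        ≡⟨ cong₂ (λ p q → p ℚ.+ q ℚ.+ [ t , u ] f)
                 (coeff-modSym u w z (det3≢0 u∈V w∈V u∦w) f) (coeff-modSym w t z (det3≢0 w∈V t∈V w∦t) f) ⟩
      (Puw ℚ.+ Pwz ℚ.+ Pzu) ℚ.+ (Pwt ℚ.+ Ptz ℚ.+ Pzw) ℚ.+ [ t , u ] f
        ≡⟨ cong (λ p → (Puw ℚ.+ Pwz ℚ.+ Pzu) ℚ.+ (Pwt ℚ.+ Ptz ℚ.+ Pzw) ℚ.+ p) (coeff-modSym t u z (det3≢0 t∈V u∈V t∦u) f) ⟩
      (Puw ℚ.+ Pwz ℚ.+ Pzu) ℚ.+ (Pwt ℚ.+ Ptz ℚ.+ Pzw) ℚ.+ (Ptu ℚ.+ Puz ℚ.+ Pzt)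
        ≡⟨ solve 9 (λ uw wz zu wt tz zw tu uz zt →
             (uw :+ wz :+ zu) :+ (wt :+ tz :+ zw) :+ (tu :+ uz :+ zt) :=
             (uw :+ wt :+ tu) :+ ((wz :+ zw) :+ (tz :+ zt) :+ (zu :+ uz))) refl Puw Pwz Pzu Pwt Ptz Pzw Ptu Puz Pzt ⟩
      (Puw ℚ.+ Pwt ℚ.+ Ptu) ℚ.+ ((Pwz ℚ.+ Pzw) ℚ.+ (Ptz ℚ.+ Pzt) ℚ.+ (Pzu ℚ.+ Puz))
        ≡⟨ cong₂ ℚ._+_ (path-triangle u∈V w∈V t∈V u≢0 w≢0 t≢0 u×w≢0 w×t≢0 t×u≢0 f)
                       (sum-zero (path-antisym w≢0 z≢0 w×z≢0 f) (path-antisym t≢0 z≢0 t×z≢0 f) (path-antisym z≢0 u≢0 z×u≢0 f)) ⟩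
      0ℚ ℚ.+ 0ℚ
        ≡⟨⟩
      0ℚ ∎
      where
      open ≡-Reasoning
      open Nondegenerate (det≢0⇒nondegenerate u w z (det3≢0 u∈V w∈V u∦w))
        renaming (v₁≢0 to u≢0; v₂≢0 to w≢0; v₃≢0 to z≢0; v₁×v₂≢0 to u×w≢0; v₂×v₃≢0 to w×z≢0; v₃×v₁≢0 to z×u≢0)
      open Nondegenerate (det≢0⇒nondegenerate w t z (det3≢0 w∈V t∈V w∦t))
        using () renaming (v₂≢0 to t≢0; v₁×v₂≢0 to w×t≢0; v₂×v₃≢0 to t×z≢0)
      open Nondegenerate (det≢0⇒nondegenerate t u z (det3≢0 t∈V u∈V t∦u))
        using () renaming (v₁×v₂≢0 to t×u≢0)
      Puw Pwz Pzu Pwt Ptz Pzw Ptu Puz Pzt : ℚ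
      Puw = path u w f ; Pwz = path w z f ; Pzu = path z u f
      Pwt = path w t f ; Ptz = path t z f ; Pzw = path z w f
      Ptu = path t u f ; Puz = path u z f ; Pzt = path z t f

    cocycle-one-parallel : ∀ {u w t} → InSpan a b u → InSpan a b w → InSpan a b t → u ≢ 0v → w ≢ 0v →
                           u ∥ w → ¬ w ∥ t → ¬ t ∥ u → ∀ f → [ u , w ] f ℚ.+ [ w , t ] f ℚ.+ [ t , u ] f ≡ 0ℚ
    cocycle-one-parallel {u} {w} {t} u∈V w∈V t∈V u≢0 w≢0 u∥w w∦t t∦u f = begin
      [ u , w ] f ℚ.+ [ w , t ] f ℚ.+ [ t , u ] f
        ≡⟨ cong₂ (λ p q → p ℚ.+ q ℚ.+ [ t , u ] f) (symbol-parallel u∥w f) (coeff-modSym w t z (det3≢0 w∈V t∈V w∦t) f) ⟩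
      0ℚ ℚ.+ (Pwt ℚ.+ Ptz ℚ.+ Pzw) ℚ.+ [ t , u ] f
        ≡⟨ cong (λ p → 0ℚ ℚ.+ (Pwt ℚ.+ Ptz ℚ.+ Pzw) ℚ.+ p) (coeff-modSym t u z (det3≢0 t∈V u∈V t∦u) f) ⟩
      0ℚ ℚ.+ (Pwt ℚ.+ Ptz ℚ.+ Pzw) ℚ.+ (Ptu ℚ.+ Puz ℚ.+ Pzt)
        ≡⟨ solve 6 (λ wt tz zw tu uz zt →
             con 0ℚ :+ (wt :+ tz :+ zw) :+ (tu :+ uz :+ zt) := (wt :+ tu) :+ (tz :+ zt) :+ (zw :+ uz)) refl Pwt Ptz Pzw Ptu Puz Pzt ⟩
      (Pwt ℚ.+ Ptu) ℚ.+ (Ptz ℚ.+ Pzt) ℚ.+ (Pzw ℚ.+ Puz)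
        ≡⟨ sum-zero telescope (path-antisym t≢0 z≢0 t×z≢0 f)
                    (trans (cong (Pzw ℚ.+_) (path-resp-∼ u∼w (∼-refl z≢0) u×z∼w×z f)) (path-antisym z≢0 w≢0 z×w≢0 f)) ⟩
      0ℚ ∎
      where
      open ≡-Reasoning
      open Nondegenerate (det≢0⇒nondegenerate w t z (det3≢0 w∈V t∈V w∦t))
        using () renaming (v₂≢0 to t≢0; v₃≢0 to z≢0; v₁×v₂≢0 to w×t≢0; v₂×v₃≢0 to t×z≢0; v₃×v₁≢0 to z×w≢0)
      open Nondegenerate (det≢0⇒nondegenerate t u z (det3≢0 t∈V u∈V t∦u))
        using () renaming (v₁×v₂≢0 to t×u≢0; v₂×v₃≢0 to u×z≢0)
      Pwt Ptz Pzw Ptu Puz Pzt : ℚ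
      Pwt = path w t f ; Ptz = path t z f ; Pzw = path z w f
      Ptu = path t u f ; Puz = path u z f ; Pzt = path z t f
      u∼w : u ∼ w
      u∼w = u≢0 , w≢0 , u∥w
      u×z∼w×z : cross u z ∼ cross w z
      u×z∼w×z = u×z≢0 , cross≢0-swap {z} {w} z×w≢0 , ∥-intro (begin
        cross (cross u z) (cross w z)   ≡⟨ cross-cross-common u w z ⟩
        det3 u w z ·v z                 ≡⟨ cong (λ n → dot n z ·v z) (cross≡0 u∥w) ⟩
        dot 0v z ·v z                   ≡⟨ cong (_·v z) (dot-zeroˡ z) ⟩
        0ℚ ·v z                         ≡⟨ ·v-zeroˡ z ⟩
        0v                              ∎)
      telescope : Pwt ℚ.+ Ptu ≡ 0ℚ
      telescope = begin
        Pwt ℚ.+ Ptu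
          ≡⟨ cong₂ ℚ._+_ (path-in-plane w∈V t∈V w≢0 t≢0 w×t≢0 f) (path-in-plane t∈V u∈V t≢0 u≢0 t×u≢0 f) ⟩
        (δ (w , N) f ℚ.- δ (t , N) f) ℚ.+ (δ (t , N) f ℚ.- δ (u , N) f)
          ≡⟨ cong (λ p → (δ (w , N) f ℚ.- δ (t , N) f) ℚ.+ (δ (t , N) f ℚ.- p)) (δ-resp-∼ u∼w (∼-refl N≢0) f) ⟩
        (δ (w , N) f ℚ.- δ (t , N) f) ℚ.+ (δ (t , N) f ℚ.- δ (w , N) f)
          ≡⟨ solve 2 (λ p q → (p :- q) :+ (q :- p) := con 0ℚ) refl (δ (w , N) f) (δ (t , N) f) ⟩
        0ℚ ∎

    cocycle-parallel : ∀ {u w t} → InSpan a b u → InSpan a b w → InSpan a b t → u ≢ 0v → w ≢ 0v →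
                       u ∥ w → ∀ f → [ u , w ] f ℚ.+ [ w , t ] f ℚ.+ [ t , u ] f ≡ 0ℚ
    cocycle-parallel {u} {w} {t} u∈V w∈V t∈V u≢0 w≢0 u∥w f with w ∥? t
    ... | yes w×t≡0 = sum-zero (symbol-parallel u∥w f) (symbol-parallel w∥t f) (symbol-parallel t∥u f)
      where
      w∥t : w ∥ t
      w∥t = ∥-intro w×t≡0
      t∥u : t ∥ u
      t∥u = ∥-trans w≢0 (∥-sym w∥t) (∥-sym u∥w)
    ... | no w×t≢0 = cocycle-one-parallel u∈V w∈V t∈V u≢0 w≢0 u∥w (w×t≢0 ∘ cross≡0) t∦u f
      where
      t∦u : ¬ t ∥ u
      t∦u t∥u = w×t≢0 (cross≡0 (∥-trans u≢0 (∥-sym u∥w) (∥-sym t∥u)))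

  cocycle : ∀ {u w t} → InSpan a b u → InSpan a b w → InSpan a b t → u ≢ 0v → w ≢ 0v → t ≢ 0v →
            ∀ f → [ u , w ] f ℚ.+ [ w , t ] f ℚ.+ [ t , u ] f ≡ 0ℚ
  cocycle {u} {w} {t} u∈V w∈V t∈V u≢0 w≢0 t≢0 f with D ≟ 0ℚ
  ... | yes D≡0 = sum-zero (symbol-flat D≡0 u∈V w∈V f) (symbol-flat D≡0 w∈V t∈V f) (symbol-flat D≡0 t∈V u∈V f)
  ... | no D≢0 with u ∥? w | w ∥? t | t ∥? u
  ...   | yes u×w≡0 | _         | _         = cocycle-parallel D≢0 u∈V w∈V t∈V u≢0 w≢0 (∥-intro u×w≡0) f
  ...   | no _      | yes w×t≡0 | _         =
    trans (+-rotate ([ u , w ] f) ([ w , t ] f) ([ t , u ] f)) (cocycle-parallel D≢0 w∈V t∈V u∈V w≢0 t≢0 (∥-intro w×t≡0) f)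
  ...   | no _      | no _      | yes t×u≡0 =
    trans (+-rotate ([ u , w ] f) ([ w , t ] f) ([ t , u ] f)) (trans (+-rotate ([ w , t ] f) ([ t , u ] f) ([ u , w ] f))
      (cocycle-parallel D≢0 t∈V u∈V w∈V t≢0 u≢0 (∥-intro t×u≡0) f))
  ...   | no u×w≢0  | no w×t≢0  | no t×u≢0  =
    cocycle-nonparallel D≢0 u∈V w∈V t∈V (u×w≢0 ∘ cross≡0) (w×t≢0 ∘ cross≡0) (t×u≢0 ∘ cross≡0) f

  symbol-antisym : ∀ {u w} → InSpan a b u → InSpan a b w → u ≢ 0v → w ≢ 0v → ∀ f → [ u , w ] f ℚ.+ [ w , u ] f ≡ 0ℚ
  symbol-antisym {u} {w} u∈V w∈V u≢0 w≢0 f = begin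
    [ u , w ] f ℚ.+ [ w , u ] f                  ≡⟨ +-identityʳ ([ u , w ] f ℚ.+ [ w , u ] f) ⟨
    [ u , w ] f ℚ.+ [ w , u ] f ℚ.+ 0ℚ           ≡⟨ cong ([ u , w ] f ℚ.+ [ w , u ] f ℚ.+_) (symbol-parallel {u} {u} (∥-intro (cross-self u)) f) ⟨
    [ u , w ] f ℚ.+ [ w , u ] f ℚ.+ [ u , u ] f  ≡⟨ cocycle u∈V w∈V u∈V u≢0 w≢0 u≢0 f ⟩
    0ℚ                                           ∎
    where open ≡-Reasoning

  exchange : ∀ {x y x′ y′} → InSpan a b x → InSpan a b y → InSpan a b x′ → InSpan a b y′ →
             x ≢ 0v → y ≢ 0v → x′ ≢ 0v → y′ ≢ 0v →
             ∀ f → [ x , x′ ] f ℚ.- [ y , y′ ] f ≡ [ y′ , x′ ] f ℚ.- [ y , x ] f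
  exchange {x} {y} {x′} {y′} x∈V y∈V x′∈V y′∈V x≢0 y≢0 x′≢0 y′≢0 f = begin
    X ℚ.- D′
      ≡⟨ solve 8 (λ A B C D E F X Y →
           X :- D := (E :- Y) :+ ((X :+ C) :- (A :+ B :+ C) :- (D :+ E :+ F) :+ (B :+ F) :+ (Y :+ A))) refl A B C D′ E F X Y ⟩
    (E ℚ.- Y) ℚ.+ ((X ℚ.+ C) ℚ.- (A ℚ.+ B ℚ.+ C) ℚ.- (D′ ℚ.+ E ℚ.+ F) ℚ.+ (B ℚ.+ F) ℚ.+ (Y ℚ.+ A))
      ≡⟨ cong ((E ℚ.- Y) ℚ.+_) (combination-zero
           (symbol-antisym x∈V x′∈V x≢0 x′≢0 f) (cocycle x∈V y∈V x′∈V x≢0 y≢0 x′≢0 f) (cocycle y∈V y′∈V x′∈V y≢0 y′≢0 x′≢0 f)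
           (symbol-antisym y∈V x′∈V y≢0 x′≢0 f) (symbol-antisym y∈V x∈V y≢0 x≢0 f)) ⟩
    (E ℚ.- Y) ℚ.+ 0ℚ
      ≡⟨ +-identityʳ (E ℚ.- Y) ⟩
    E ℚ.- Y ∎
    where
    open ≡-Reasoning
    A B C D′ E F X Y : ℚ
    A = [ x , y ] f ; B = [ y , x′ ] f ; C = [ x′ , x ] f ; D′ = [ y , y′ ] f
    E = [ y′ , x′ ] f ; F = [ x′ , y ] f ; X = [ x , x′ ] f ; Y = [ y , x ] f
    combination-zero : ∀ {p q r s t} → p ≡ 0ℚ → q ≡ 0ℚ → r ≡ 0ℚ → s ≡ 0ℚ → t ≡ 0ℚ → p ℚ.- q ℚ.- r ℚ.+ s ℚ.+ t ≡ 0ℚ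
    combination-zero refl refl refl refl refl = refl

SL⇒det-rows≢0 : ∀ g → InSL3Z g → det-rows g ≢ 0ℚ
SL⇒det-rows≢0 g g∈SL det≡0 with trans (sym (det-rows-SL g g∈SL)) det≡0
... | ()

coeff-actC-modSym-± : ∀ g {u v w} → det-rows g ≢ 0ℚ → (g ⊙ w ≡ w) ⊎ (g ⊙ w ≡ -v w) →
                      ∀ f → coeff (actC g (modSym u v w)) f ≡ coeff (modSym (g ⊙ u) (g ⊙ v) w) f
coeff-actC-modSym-± g {u} {v} {w} det≢0 (inj₁ gw≡w) f =
  cong (λ c → coeff c f) (trans (actC-modSym g det≢0 u v w) (cong (modSym (g ⊙ u) (g ⊙ v)) gw≡w))
coeff-actC-modSym-± g {u} {v} {w} det≢0 (inj₂ gw≡-w) f =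
  trans (cong (λ c → coeff c f) (trans (actC-modSym g det≢0 u v w) (cong (modSym (g ⊙ u) (g ⊙ v)) gw≡-w)))
        (coeff-modSym-negʳ (g ⊙ u) (g ⊙ v) w f)

coeff-action-difference : ∀ g m f → coeff ((actC g m ++ negC m) ++ []) f ≡ coeff (actC g m) f ℚ.- coeff m f
coeff-action-difference g m f = begin
  coeff ((actC g m ++ negC m) ++ []) f      ≡⟨ cong (λ c → coeff c f) (++-identityʳ (actC g m ++ negC m)) ⟩
  coeff (actC g m ++ negC m) f              ≡⟨ coeff-++ (actC g m) (negC m) f ⟩
  coeff (actC g m) f ℚ.+ coeff (negC m) f   ≡⟨ cong (coeff (actC g m) f ℚ.+_) (coeff-negC m f) ⟩
  coeff (actC g m) f ℚ.- coeff m f          ∎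
  where open ≡-Reasoning

lemma5p9 : (Γ : Mat → Set) → FiniteIndexSubgroup Γ →
    (x y z : Q3) → x ≢ 0v → y ≢ 0v → z ≢ 0v →
    (a b : Q3) → LinIndep2 a b →
    InSpan a b x → InSpan a b y → ¬ InSpan a b z →
    (γ : Mat) → Γ γ →
    (∀ w → InSpan a b w → InSpan a b (γ ⊙ w)) →
    (∀ w → InSpan a b w → Σ Q3 λ w' → InSpan a b w' × (γ ⊙ w' ≡ w)) →
    ((γ ⊙ z ≡ z) ⊎ (γ ⊙ z ≡ -v z)) →
    CoinvEq Γ (modSym x (γ ⊙ x) z) (modSym y (γ ⊙ y) z)
lemma5p9 Γ Γ-fi x y z x≢0 y≢0 _ a b _ x∈V y∈V _ γ γ∈Γ γV⊆V _ γz≡±z =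
  (γ , modSym y x z) ∷ [] , (γ∈Γ , modSym-isCycle y x z) ∷ᴬ []ᴬ , λ f _ → begin
    [ x , γ ⊙ x ] f ℚ.- [ y , γ ⊙ y ] f
      ≡⟨ exchange x∈V y∈V (γV⊆V x x∈V) (γV⊆V y y∈V) x≢0 y≢0 (⊙-≢0 γ det≢0 x≢0) (⊙-≢0 γ det≢0 y≢0) f ⟩
    [ γ ⊙ y , γ ⊙ x ] f ℚ.- [ y , x ] f
      ≡⟨ cong (ℚ._- [ y , x ] f) (coeff-actC-modSym-± γ det≢0 γz≡±z f) ⟨
    coeff (actC γ (modSym y x z)) f ℚ.- coeff (modSym y x z) f
      ≡⟨ coeff-action-difference γ (modSym y x z) f ⟨
    coeff ((actC γ (modSym y x z) ++ negC (modSym y x z)) ++ []) f ∎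
  where
  open Plane a b z
  open ≡-Reasoning
  det≢0 : det-rows γ ≢ 0ℚ
  det≢0 = SL⇒det-rows≢0 γ (FiniteIndexSubgroup.⊆SL Γ-fi γ γ∈Γ)
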